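{- Let $G$ be a connected undirected graph and let $T_1,T_2\subseteq V(G)$ be vertex sets such that for each $i\in\{1,2\}$, $G[T_i]$ is connected and each connected component of $G-T_i$ is adjacent to exactly one vertex of $T_i$. If $T_1\cap T_2\neq\emptyset$, then each connected component of $G-(T_1\cup T_2)$ is adjacent to exactly one vertex of $T_1\cup T_2$. -}

module Defs where

open import Data.Nat using (ℕ)
open import Data.Fin using (Fin)
open import Data.Product using (Σ; ∃; _×_; _,_)
open import Data.Sum using (_⊎_)
open import Relation.Nullary using (¬_)
open import Relation.Binary.PropositionalEquality using (_≡_)

record Graph (n : ℕ) : Set₁ where
  field
    Adj   : Fin n → Fin n → Set
    sym   : ∀ {u v} → Adj u v → Adj v u
    irrefl : ∀ {u} → ¬ Adj u u
open Graph public

VSet : ℕ → Set₁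
VSet n = Fin n → Set

_∪_ : ∀ {n} → VSet n → VSet n → VSet n
(A ∪ B) v = A v ⊎ B v

-- complement: vertex set of G - T
∁ : ∀ {n} → VSet n → VSet n
∁ A v = ¬ A v

-- Walks in G staying inside the vertex set S (i.e. walks in G[S]).
data Reach {n} (G : Graph n) (S : VSet n) : Fin n → Fin n → Set where
  here : ∀ {u} → S u → Reach G S u u
  step : ∀ {u w v} → S u → Adj G u w → Reach G S w v → Reach G S u v

ConnectedIn : ∀ {n} → Graph n → VSet n → Set
ConnectedIn G S = ∀ u v → S u → S v → Reach G S u v

Connected : ∀ {n} → Graph n → Set
Connected G = ConnectedIn G (λ _ → Data.Unit.⊤)
  where import Data.Unit

-- C is a connected component of G[S]: nonempty, contained in S, connected,
-- and maximal (closed under adjacency inside S).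
IsComponent : ∀ {n} → Graph n → VSet n → VSet n → Set
IsComponent G S C =
  (∃ λ c → C c)
  × (∀ v → C v → S v)
  × ConnectedIn G C
  × (∀ u v → C u → Adj G u v → S v → C v)

AdjacentTo : ∀ {n} → Graph n → VSet n → Fin n → Set
AdjacentTo G C t = ∃ λ c → C c × Adj G c t

AdjExactlyOne : ∀ {n} → Graph n → VSet n → VSet n → Set
AdjExactlyOne G C T =
  ∃ λ t → T t × AdjacentTo G C t × (∀ t' → T t' → AdjacentTo G C t' → t' ≡ t)

EachComponentAdjOne : ∀ {n} → Graph n → VSet n → Set₁
EachComponentAdjOne G T = ∀ (C : VSet _) → IsComponent G (∁ T) C → AdjExactlyOne G C T

{-# OPTIONS --safe #-}
-- Let C be a component of G − (T₁ ∪ T₂) and Dᵢ the component of G − Tᵢ containing C,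
-- attached to Tᵢ only at tᵢ. Every neighbour of C in T₁ ∪ T₂ is t₁ or t₂, and a walk
-- from C to a vertex v ∈ T₁ ∩ T₂ shows that C has such a neighbour. If C is adjacent
-- to both t₁ ≠ t₂, then t₁ ∉ T₂, so t₁ ∈ D₂; a walk inside T₁ from t₁ to v ∉ D₂ must
-- leave D₂ through t₂, so t₂ ∈ T₁ is a neighbour of D₁ in T₁, whence t₂ = t₁.
module Submission where

open import Defs
open import Data.Fin using (_≟_)
open import Data.Product using (∃; _×_; _,_; proj₁)
open import Data.Sum using (_⊎_; inj₁; inj₂)
open import Data.Empty using (⊥-elim)
open import Function using (_∘_)
open import Relation.Nullary using (¬_; yes; no)
open import Relation.Unary using (_⊆_)
open import Relation.Binary.PropositionalEquality using (_≡_; subst; trans)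
  renaming (sym to ≡-sym)

module _ {n} (G : Graph n) where

  source-∈ : ∀ {S u v} → Reach G S u v → S u
  source-∈ (here u∈S)     = u∈S
  source-∈ (step u∈S _ _) = u∈S

  target-∈ : ∀ {S u v} → Reach G S u v → S v
  target-∈ (here v∈S)   = v∈S
  target-∈ (step _ _ r) = target-∈ r

  snoc : ∀ {S u v w} → Reach G S u v → Adj G v w → S w → Reach G S u w
  snoc (here v∈S)       v~w w∈S = step v∈S v~w (here w∈S)
  snoc (step u∈S u~x r) v~w w∈S = step u∈S u~x (snoc r v~w w∈S)

  reverse : ∀ {S u v} → Reach G S u v → Reach G S v u
  reverse (here u∈S)       = here u∈S
  reverse (step u∈S u~w r) = snoc (reverse r) (Graph.sym G u~w) u∈S

  _++_ : ∀ {S u v w} → Reach G S u v → Reach G S v w → Reach G S u w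
  here _         ++ r′ = r′
  step u∈S u~x r ++ r′ = step u∈S u~x (r ++ r′)

  Reach-mono : ∀ {S S′ u v} → S ⊆ S′ → Reach G S u v → Reach G S′ u v
  Reach-mono S⊆S′ (here u∈S)       = here (S⊆S′ u∈S)
  Reach-mono S⊆S′ (step u∈S u~w r) = step (S⊆S′ u∈S) u~w (Reach-mono S⊆S′ r)

  Reach-within : ∀ {S c u v} → Reach G S c u → Reach G S u v → Reach G (Reach G S c) u v
  Reach-within c⇝u (here _)         = here c⇝u
  Reach-within c⇝u (step _ u~w w⇝v) = step c⇝u u~w (Reach-within (snoc c⇝u u~w (source-∈ w⇝v)) w⇝v)

  reach-isComponent : ∀ {T c} → ¬ T c → IsComponent G (∁ T) (Reach G (∁ T) c)
  reach-isComponent {c = c} c∉T =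
      (c , here c∉T)
    , (λ _ → target-∈)
    , (λ _ _ c⇝u c⇝v → Reach-within c⇝u (reverse c⇝u ++ c⇝v))
    , (λ _ _ c⇝u u~v v∉T → snoc c⇝u u~v v∉T)

  connected⇒⊆reach : ∀ {S C c} → ConnectedIn G C → C c → C ⊆ S → C ⊆ Reach G S c
  connected⇒⊆reach C-conn c∈C C⊆S {x} x∈C = Reach-mono C⊆S (C-conn _ x c∈C x∈C)

  AdjacentTo-mono : ∀ {C D t} → C ⊆ D → AdjacentTo G C t → AdjacentTo G D t
  AdjacentTo-mono C⊆D (x , x∈C , x~t) = x , C⊆D x∈C , x~t

  Exits : VSet n → VSet n → Set
  Exits D E = ∀ {a b} → D a → Adj G a b → E b ⊎ D b

  exit-on-walk : ∀ {S D E x y} → Exits D E → Reach G S x y → D x → ¬ D y →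
                 ∃ λ e → E e × S e × AdjacentTo G D e
  exit-on-walk exits (here _) x∈D y∉D = ⊥-elim (y∉D x∈D)
  exit-on-walk exits (step {u} {w} _ u~w w⇝y) u∈D y∉D with exits u∈D u~w
  ... | inj₁ w∈E = w , w∈E , source-∈ w⇝y , u , u∈D , u~w
  ... | inj₂ w∈D = exit-on-walk exits w⇝y w∈D y∉D

  NeighboursDecide : VSet n → VSet n → Set
  NeighboursDecide D T = ∀ {a b} → D a → Adj G a b → T b ⊎ ¬ T b

  -- Membership in T is undecidable in general, but a neighbour b of D is either the
  -- unique attachment t (decidable on Fin n) or outside T.
  attached⇒neighboursDecide : ∀ {D T} → AdjExactlyOne G D T → NeighboursDecide D T
  attached⇒neighboursDecide (t , t∈T , _ , only) {a} {b} a∈D a~b with b ≟ t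
  ... | yes b≡t = inj₁ (subst _ (≡-sym b≡t) t∈T)
  ... | no  b≢t = inj₂ (λ b∈T → b≢t (only b b∈T (a , a∈D , a~b)))

  NeighboursDecide-∪ : ∀ {D T₁ T₂} → NeighboursDecide D T₁ → NeighboursDecide D T₂ →
                       NeighboursDecide D (T₁ ∪ T₂)
  NeighboursDecide-∪ decide₁ decide₂ a∈D a~b with decide₁ a∈D a~b | decide₂ a∈D a~b
  ... | inj₁ b∈T₁ | _         = inj₁ (inj₁ b∈T₁)
  ... | inj₂ _    | inj₁ b∈T₂ = inj₁ (inj₂ b∈T₂)
  ... | inj₂ b∉T₁ | inj₂ b∉T₂ = inj₂ λ { (inj₁ b∈T₁) → b∉T₁ b∈T₁ ; (inj₂ b∈T₂) → b∉T₂ b∈T₂ }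

  component-exits : ∀ {C T} → IsComponent G (∁ T) C → NeighboursDecide C T → Exits C T
  component-exits (_ , _ , _ , closed) decide {a} {b} a∈C a~b with decide a∈C a~b
  ... | inj₁ b∈T = inj₁ b∈T
  ... | inj₂ b∉T = inj₂ (closed a b a∈C a~b b∉T)

  connected-contains-attachment :
    ∀ {T₁ T₂ D v s} → ConnectedIn G T₁ → T₁ v → T₂ v →
    IsComponent G (∁ T₂) D → (D-att : AdjExactlyOne G D T₂) →
    T₁ s → AdjacentTo G D s → ¬ T₂ s → T₁ (proj₁ D-att)
  connected-contains-attachment {v = v} {s} T₁-conn v∈T₁ v∈T₂
    D-comp@(_ , D⊆∁T₂ , _ , closed) D-att@(_ , _ , _ , only) s∈T₁ (x , x∈D , x~s) s∉T₂
    with exit-on-walk (component-exits D-comp (attached⇒neighboursDecide D-att))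
                      (T₁-conn s v s∈T₁ v∈T₁) (closed x s x∈D x~s s∉T₂) (λ v∈D → D⊆∁T₂ v v∈D v∈T₂)
  ... | e , e∈T₂ , e∈T₁ , D~e = subst _ (only e e∈T₂ D~e) e∈T₁

  InAttachedComponent : VSet n → VSet n → Set₁
  InAttachedComponent C T = ∃ λ D → IsComponent G (∁ T) D × AdjExactlyOne G D T × C ⊆ D

  inAttachedComponent : ∀ {T C c} → EachComponentAdjOne G T →
                        ConnectedIn G C → C c → C ⊆ ∁ T → InAttachedComponent C T
  inAttachedComponent {T} {c = c} T-att C-conn c∈C C⊆∁T =
    _ , D-comp , T-att _ D-comp , connected⇒⊆reach C-conn c∈C C⊆∁T
    where
    D-comp : IsComponent G (∁ T) (Reach G (∁ T) c)
    D-comp = reach-isComponent (C⊆∁T c∈C)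

  inAttached⇒neighboursDecide : ∀ {C T} → InAttachedComponent C T → NeighboursDecide C T
  inAttached⇒neighboursDecide (_ , _ , D-att , C⊆D) a∈C = attached⇒neighboursDecide D-att (C⊆D a∈C)

  attachment-unique : ∀ {C T s s′} → InAttachedComponent C T →
                      T s → AdjacentTo G C s → T s′ → AdjacentTo G C s′ → s ≡ s′
  attachment-unique (_ , _ , (_ , _ , _ , only) , C⊆D) s∈T C~s s′∈T C~s′ =
    trans (only _ s∈T (AdjacentTo-mono C⊆D C~s)) (≡-sym (only _ s′∈T (AdjacentTo-mono C⊆D C~s′)))

  attachments-agree :
    ∀ {T₁ T₂ C v s₁ s₂} → ConnectedIn G T₁ → T₁ v → T₂ v →
    InAttachedComponent C T₁ → InAttachedComponent C T₂ →
    T₁ s₁ → AdjacentTo G C s₁ → T₂ s₂ → AdjacentTo G C s₂ → s₁ ≡ s₂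
  attachments-agree {T₁} {T₂} {s₁ = s₁} {s₂} T₁-conn v∈T₁ v∈T₂ C-in-D₁
    C-in-D₂@(_ , D₂-comp , D₂-att@(_ , _ , _ , only₂) , C⊆D₂) s₁∈T₁ C~s₁ s₂∈T₂ C~s₂
    with s₁ ≟ s₂
  ... | yes s₁≡s₂ = s₁≡s₂
  ... | no  s₁≢s₂ = ⊥-elim (s₁≢s₂ (attachment-unique C-in-D₁ s₁∈T₁ C~s₁ s₂∈T₁ C~s₂))
    where
    s₁∉T₂ : ¬ T₂ s₁
    s₁∉T₂ s₁∈T₂ = s₁≢s₂ (attachment-unique C-in-D₂ s₁∈T₂ C~s₁ s₂∈T₂ C~s₂)
    t₂∈T₁ : T₁ (proj₁ D₂-att)
    t₂∈T₁ = connected-contains-attachment T₁-conn v∈T₁ v∈T₂ D₂-comp D₂-att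
              s₁∈T₁ (AdjacentTo-mono C⊆D₂ C~s₁) s₁∉T₂
    s₂∈T₁ : T₁ s₂
    s₂∈T₁ = subst T₁ (≡-sym (only₂ s₂ s₂∈T₂ (AdjacentTo-mono C⊆D₂ C~s₂))) t₂∈T₁

  attachment-unique-∪ :
    ∀ {T₁ T₂ C v} → ConnectedIn G T₁ → ConnectedIn G T₂ → T₁ v → T₂ v →
    InAttachedComponent C T₁ → InAttachedComponent C T₂ →
    ∀ {s s′} → (T₁ ∪ T₂) s → AdjacentTo G C s → (T₁ ∪ T₂) s′ → AdjacentTo G C s′ → s ≡ s′
  attachment-unique-∪ _ _ _ _ C-in-D₁ _ (inj₁ s∈T₁) C~s (inj₁ s′∈T₁) C~s′ =
    attachment-unique C-in-D₁ s∈T₁ C~s s′∈T₁ C~s′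
  attachment-unique-∪ _ _ _ _ _ C-in-D₂ (inj₂ s∈T₂) C~s (inj₂ s′∈T₂) C~s′ =
    attachment-unique C-in-D₂ s∈T₂ C~s s′∈T₂ C~s′
  attachment-unique-∪ T₁-conn _ v∈T₁ v∈T₂ C-in-D₁ C-in-D₂ (inj₁ s∈T₁) C~s (inj₂ s′∈T₂) C~s′ =
    attachments-agree T₁-conn v∈T₁ v∈T₂ C-in-D₁ C-in-D₂ s∈T₁ C~s s′∈T₂ C~s′
  attachment-unique-∪ _ T₂-conn v∈T₁ v∈T₂ C-in-D₁ C-in-D₂ (inj₂ s∈T₂) C~s (inj₁ s′∈T₁) C~s′ =
    attachments-agree T₂-conn v∈T₂ v∈T₁ C-in-D₂ C-in-D₁ s∈T₂ C~s s′∈T₁ C~s′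

lemma49 : ∀ {n} (G : Graph n) (T₁ T₂ : VSet n)
    → Connected G
    → ConnectedIn G T₁ → EachComponentAdjOne G T₁
    → ConnectedIn G T₂ → EachComponentAdjOne G T₂
    → (∃ λ v → T₁ v × T₂ v)
    → EachComponentAdjOne G (T₁ ∪ T₂)
lemma49 G T₁ T₂ G-conn T₁-conn T₁-att T₂-conn T₂-att (v , v∈T₁ , v∈T₂)
        C C-comp@((c , c∈C) , C⊆∁T , C-conn , _) =
  let t , t∈T , _ , C~t = exit-on-walk G (component-exits G C-comp decide) (G-conn c v _ _)
                                        c∈C (λ v∈C → C⊆∁T₁ v∈C v∈T₁)
  in  t , t∈T , C~t , λ s s∈T C~s → unique s∈T C~s t∈T C~t
  where
  C⊆∁T₁ : C ⊆ ∁ T₁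
  C⊆∁T₁ x∈C = C⊆∁T _ x∈C ∘ inj₁
  C⊆∁T₂ : C ⊆ ∁ T₂
  C⊆∁T₂ x∈C = C⊆∁T _ x∈C ∘ inj₂
  C-in-D₁ : InAttachedComponent G C T₁
  C-in-D₁ = inAttachedComponent G T₁-att C-conn c∈C C⊆∁T₁
  C-in-D₂ : InAttachedComponent G C T₂
  C-in-D₂ = inAttachedComponent G T₂-att C-conn c∈C C⊆∁T₂
  decide : NeighboursDecide G C (T₁ ∪ T₂)
  decide = NeighboursDecide-∪ G (inAttached⇒neighboursDecide G C-in-D₁)
                                (inAttached⇒neighboursDecide G C-in-D₂)
  unique : ∀ {s s′} → (T₁ ∪ T₂) s → AdjacentTo G C s → (T₁ ∪ T₂) s′ → AdjacentTo G C s′ → s ≡ s′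
  unique = attachment-unique-∪ G T₁-conn T₂-conn v∈T₁ v∈T₂ C-in-D₁ C-in-D₂
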